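{- If a closeness space $X$ is totally bounded and pointed (i.e. an element of $X$ is given), then $X$ is uniformly continuously searchable.
   Context: We work in constructive Martin-Löf type theory; "there is" means an explicit witness. $\mathbb{N}_\infty$ is the type of decreasing binary sequences $u:\mathbb{N}\to\{0,1\}$; $\underline{n}$ is $n$ ones followed by zeros, $\infty$ the constant $1$ sequence; $u\preceq v$ iff $\forall n\,(u_n=1\Rightarrow v_n=1)$; $\min$ is pointwise. A closeness space is a type $X$ with $c:X\to X\to\mathbb{N}_\infty$ such that $c(x,y)=\infty\iff x=y$, $c(x,y)=c(y,x)$, and $\min(c(x,y),c(y,z))\preceq c(x,z)$. $C_\varepsilon(x,y)$ means $\underline{\varepsilon}\preceq c(x,y)$. A type is finite linearly ordered if it is equipped with an equivalence to $\{0,\dots,n-1\}$ for some $n\in\mathbb{N}$. An $\varepsilon$-net of $X$ is a finite linearly ordered type $X'$ with functions $g:X'\to X$ and $h:X\to X'$ such that $C_\varepsilon(x,g(h(x)))$ for all $x\in X$; $X$ is totally bounded if it has an $\varepsilon$-net for every $\varepsilon\in\mathbb{N}$. A predicate $p$ on $X$ is decidable if $p(x)$ or $\neg p(x)$ can be decided for every $x$, and uniformly continuous if there is $\delta\in\mathbb{N}$ with $C_\delta(x_1,x_2)\Rightarrow(p(x_1)\Leftrightarrow p(x_2))$. $X$ is uniformly continuously searchable if for every decidable predicate $p$ given with a modulus of uniform continuity there is $x_0\in X$ such that if some $x\in X$ satisfies $p$ then $p(x_0)$. -}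

module Defs where

open import Level using (Level; _⊔_)
open import Data.Nat using (ℕ; zero; suc)
open import Data.Bool using (Bool; true; false)
open import Data.Fin using (Fin)
open import Data.Product using (Σ; Σ-syntax; _×_; _,_; proj₁; proj₂)
open import Relation.Binary.PropositionalEquality using (_≡_; refl)
open import Relation.Nullary using (Dec)
open import Function.Bundles using (_↔_)

-- Binary digits {0,1} are represented by Bool (false = 0, true = 1).

is-decreasing : (ℕ → Bool) → Set
is-decreasing u = ∀ n → u (suc n) ≡ true → u n ≡ true

ℕ∞ : Set
ℕ∞ = Σ (ℕ → Bool) is-decreasing

seq : ℕ∞ → ℕ → Bool
seq = Data.Product.proj₁

underline-seq : ℕ → ℕ → Bool
underline-seq zero    i       = false
underline-seq (suc n) zero    = true
underline-seq (suc n) (suc i) = underline-seq n i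

underline-dec : ∀ n → is-decreasing (underline-seq n)
underline-dec zero    i ()
underline-dec (suc n) zero    _ = refl
underline-dec (suc n) (suc i) e = underline-dec n i e

underline : ℕ → ℕ∞
underline n = underline-seq n , underline-dec n

∞ : ℕ∞
∞ = (λ _ → true) , (λ _ _ → Relation.Binary.PropositionalEquality.refl)

_≼_ : ℕ∞ → ℕ∞ → Set
u ≼ v = ∀ n → seq u n ≡ true → seq v n ≡ true

minℕ∞ : ℕ∞ → ℕ∞ → ℕ∞
minℕ∞ u v = (λ n → seq u n ∧ seq v n) , dec
  where
  open Data.Bool using (_∧_)
  dec : ∀ n → (seq u (suc n) ∧ seq v (suc n)) ≡ true
            → (seq u n ∧ seq v n) ≡ true
  dec n e with seq u (suc n) in eu | seq v (suc n) in ev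
  dec n refl | true | true
    rewrite proj₂ u n eu | proj₂ v n ev = refl

record IsClosenessSpace {ℓ : Level} (X : Set ℓ) : Set ℓ where
  field
    c          : X → X → ℕ∞
    c-∞⇒≡      : ∀ x y → c x y ≡ ∞ → x ≡ y
    ≡⇒c-∞      : ∀ x y → x ≡ y → c x y ≡ ∞
    c-sym      : ∀ x y → c x y ≡ c y x
    c-ultra    : ∀ x y z → minℕ∞ (c x y) (c y z) ≼ c x z

ClosenessSpace : (ℓ : Level) → Set (Level.suc ℓ)
ClosenessSpace ℓ = Σ (Set ℓ) IsClosenessSpace

⟨_⟩ : {ℓ : Level} → ClosenessSpace ℓ → Set ℓ
⟨ X ⟩ = Data.Product.proj₁ X

c⟨_⟩ : {ℓ : Level} (X : ClosenessSpace ℓ) → ⟨ X ⟩ → ⟨ X ⟩ → ℕ∞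
c⟨ X ⟩ = IsClosenessSpace.c (Data.Product.proj₂ X)

C : {ℓ : Level} (X : ClosenessSpace ℓ) → ℕ → ⟨ X ⟩ → ⟨ X ⟩ → Set
C X ε x y = underline ε ≼ c⟨ X ⟩ x y

finite-linear-order : {ℓ : Level} → Set ℓ → Set ℓ
finite-linear-order X' = Σ ℕ (λ n → X' ↔ Fin n)

_net-of_ : {ℓ : Level} → ℕ → ClosenessSpace ℓ → Set (Level.suc ℓ)
_net-of_ {ℓ} ε X =
  Σ (Set ℓ) (λ X' →
    (Σ (X' → ⟨ X ⟩) (λ g → Σ (⟨ X ⟩ → X') (λ h →
       ∀ x → C X ε x (g (h x)))))
    × finite-linear-order X')

totally-bounded : {ℓ : Level} → ClosenessSpace ℓ → Set (Level.suc ℓ)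
totally-bounded X = ∀ ε → ε net-of X

is-decidable-predicate : {ℓ ℓ' : Level} {A : Set ℓ} → (A → Set ℓ') → Set (ℓ ⊔ ℓ')
is-decidable-predicate p = ∀ x → Dec (p x)

is-u-mod-of : {ℓ ℓ' : Level} (X : ClosenessSpace ℓ) → (⟨ X ⟩ → Set ℓ') → ℕ → Set (ℓ ⊔ ℓ')
is-u-mod-of X p δ = ∀ x₁ x₂ → C X δ x₁ x₂ → (p x₁ → p x₂) × (p x₂ → p x₁)

record decidable-uc-predicate {ℓ : Level} (ℓ' : Level) (X : ClosenessSpace ℓ) : Set (ℓ ⊔ Level.suc ℓ') where
  field
    pred     : ⟨ X ⟩ → Set ℓ'
    pred-dec : is-decidable-predicate pred
    δ        : ℕ
    pred-uc  : is-u-mod-of X pred δ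

uc-searchable : {ℓ : Level} (ℓ' : Level) → ClosenessSpace ℓ → Set (ℓ ⊔ Level.suc ℓ')
uc-searchable ℓ' X =
  (P : decidable-uc-predicate ℓ' X) →
  let open decidable-uc-predicate P in
  Σ ⟨ X ⟩ (λ x₀ → Σ ⟨ X ⟩ pred → pred x₀)

-- For a predicate p with modulus δ, take a δ-net g, h of X.  Every x is δ-close to
-- g (h x), so p has a witness in X iff p ∘ g has one in the finite net, which can be
-- decided by exhaustive search; the given point serves as the answer otherwise.
module Submission where

open import Defs
open import Level using (Level)
open import Data.Nat using (ℕ)
open import Data.Fin using (Fin)
open import Data.Fin.Properties using (any?)
open import Data.Empty using (⊥-elim)
open import Data.Product using (Σ; _,_; proj₁)
open import Function.Bundles using (Inverse)
open import Relation.Nullary using (Dec; yes; no)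
open import Relation.Binary.PropositionalEquality using (subst; sym)

finite-linear-order⇒∃-dec : {ℓ ℓ' : Level} {A : Set ℓ} {p : A → Set ℓ'}
  → finite-linear-order A → is-decidable-predicate p → Dec (Σ A p)
finite-linear-order⇒∃-dec {p = p} (n , A↔Fin) p? = search (any? (λ i → p? (from i)))
  where
  open Inverse A↔Fin

  search : Dec (Σ (Fin n) (λ i → p (from i))) → Dec (Σ _ p)
  search (yes (i , pi)) = yes (from i , pi)
  search (no ¬∃i) = no λ (a , pa) → ¬∃i (to a , subst p (sym (strictlyInverseʳ a)) pa)

net-reflects-witness : {ℓ ℓ' : Level} (X : ClosenessSpace ℓ) (ε : ℕ) {p : ⟨ X ⟩ → Set ℓ'}
  {X' : Set ℓ} (g : X' → ⟨ X ⟩) (h : ⟨ X ⟩ → X')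
  → (∀ x → C X ε x (g (h x))) → is-u-mod-of X p ε
  → Σ ⟨ X ⟩ p → Σ X' (λ x' → p (g x'))
net-reflects-witness X ε g h close p-uc (x , px) = h x , proj₁ (p-uc x (g (h x)) (close x)) px

theorem3p88 : {ℓ ℓ' : Level} (X : ClosenessSpace ℓ)
    → ⟨ X ⟩
    → totally-bounded X
    → uc-searchable ℓ' X
theorem3p88 X x₀ tb P = search (tb δ)
  where
  open decidable-uc-predicate P

  search : δ net-of X → Σ ⟨ X ⟩ (λ x → Σ ⟨ X ⟩ pred → pred x)
  search (X' , (g , h , close) , X'-finite)
    with finite-linear-order⇒∃-dec X'-finite (λ x' → pred-dec (g x'))
  ... | yes (x' , px') = g x' , λ _ → px'
  ... | no ¬∃x' = x₀ , λ ∃x → ⊥-elim (¬∃x' (net-reflects-witness X δ g h close pred-uc ∃x))
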